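{- For every $k\in\mathbb{N}$, $c(\mathbb{R}^{k+1})=c(\mathcal{L}^k)=1$.
   Context: Two distinct letters $\mathtt a,\mathtt b$ alternate in a word $w$ if deleting all other letters yields one of $(\mathtt{ab})^n$, $(\mathtt{ab})^n\mathtt a$, $(\mathtt{ba})^n$, $(\mathtt{ba})^n\mathtt b$ for some $n\ge1$. A graph $G=(V,E)$ is represented by $w$ if the set of letters of $w$ is $V$ and distinct $\mathtt a,\mathtt b\in V$ alternate in $w$ iff $\{\mathtt a,\mathtt b\}\in E$. A word is $k$-uniform if each of its letters occurs exactly $k$ times; $\mathbb{R}^k$ is the class of graphs represented by some $k$-uniform word. A marking sequence for $w$ is an enumeration $(\mathtt a_1,\dots,\mathtt a_n)$ of the distinct letters of $w$; at stage $i$ all occurrences of $\mathtt a_1,\dots,\mathtt a_i$ are marked, and a marked block is a maximal factor of consecutive marked positions; $w$ is $k$-local if some marking sequence gives at most $k$ marked blocks at every stage. $\mathcal L^k$ is the class of graphs represented by some $k$-local word. For $i,j\in\mathbb{N}_0$, $\mathscr{E}_{i,j}$ is the class of graphs whose node set can be partitioned into $i$ sets inducing independent sets and $j$ sets inducing cliques. For a hereditary class $X$ (closed under induced subgraphs), its index $c(X)$ is the largest $k\in\mathbb{N}$ such that $\mathscr{E}_{i,k-i}\subseteq X$ for some $i$. -}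

module Defs where

open import Data.Nat using (ℕ; zero; suc; _+_; _≤_; _∸_)
open import Data.Bool using (Bool; true; false; _∧_; not; if_then_else_)
open import Data.Fin using (Fin; _≟_)
open import Data.List using (List; []; _∷_; filter; length; take)
open import Data.List.Membership.Propositional using (_∈_)
import Data.List.Membership.DecPropositional as DecMem
open import Data.List.Relation.Unary.Unique.Propositional using (Unique)
open import Data.Product using (Σ; _×_; _,_)
open import Data.Sum using (_⊎_; inj₁; inj₂)
open import Data.Empty using (⊥)
open import Relation.Nullary using (¬_; does)
open import Relation.Nullary.Decidable using (_⊎-dec_)
open import Relation.Binary.PropositionalEquality using (_≡_; _≢_)
open import Function.Bundles using (_⇔_)

record Graph : Set₁ where
  field
    n     : ℕ
    Edge  : Fin n → Fin n → Set
    sym   : ∀ {u v} → Edge u v → Edge v u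
    irrefl : ∀ {u} → ¬ Edge u u
open Graph public

GraphClass : Set₁
GraphClass = Graph → Set

_⊆G_ : GraphClass → GraphClass → Set₁
X ⊆G Y = ∀ G → X G → Y G

altFrom : {A : Set} → A → A → ℕ → List A
altFrom a b zero    = []
altFrom a b (suc m) = a ∷ altFrom b a m

restrict : ∀ {n} → List (Fin n) → Fin n → Fin n → List (Fin n)
restrict w a b = filter (λ x → (x ≟ a) ⊎-dec (x ≟ b)) w

-- a, b alternate in w: deleting the other letters yields (ab)^m, (ab)^m a,
-- (ba)^m or (ba)^m b with m ≥ 1, i.e. altFrom a b l or altFrom b a l, l ≥ 2
Alternate : ∀ {n} → List (Fin n) → Fin n → Fin n → Set
Alternate w a b =
  a ≢ b × Σ ℕ (λ l → 2 ≤ l × (restrict w a b ≡ altFrom a b l ⊎ restrict w a b ≡ altFrom b a l))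

Represents : (G : Graph) → List (Fin (n G)) → Set
Represents G w =
  (∀ v → v ∈ w) × (∀ a b → a ≢ b → (Edge G a b ⇔ Alternate w a b))

occ : ∀ {n} → Fin n → List (Fin n) → ℕ
occ v w = length (filter (_≟ v) w)

Uniform : ∀ {n} → ℕ → List (Fin n) → Set
Uniform k w = ∀ v → occ v w ≡ k

R : ℕ → GraphClass
R k G = Σ (List (Fin (n G))) λ w → Represents G w × Uniform k w

-- number of maximal factors of consecutive marked positions
-- (prev = whether the previous position was marked)
blocksFrom : {A : Set} → (A → Bool) → Bool → List A → ℕ
blocksFrom m prev []       = 0
blocksFrom m prev (x ∷ xs) =
  (if m x ∧ not prev then 1 else 0) + blocksFrom m (m x) xs

markedBlocks : ∀ {n} → List (Fin n) → List (Fin n) → ℕ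
markedBlocks {n} marked w = blocksFrom (λ x → does (x ∈? marked)) false w
  where open DecMem (_≟_ {n}) using (_∈?_)

MarkingSequence : ∀ {n} → List (Fin n) → List (Fin n) → Set
MarkingSequence w σ = Unique σ × (∀ x → (x ∈ σ ⇔ x ∈ w))

Local : ∀ {n} → ℕ → List (Fin n) → Set
Local k w = Σ _ λ σ → MarkingSequence w σ ×
  (∀ i → i ≤ length σ → markedBlocks (take i σ) w ≤ k)

L : ℕ → GraphClass
L k G = Σ (List (Fin (n G))) λ w → Represents G w × Local k w

-- (i,j)-graphs: nodes partitioned into i independent sets and j cliques
-- (parts may be empty)

E : ℕ → ℕ → GraphClass
E i j G = Σ (Fin (n G) → Fin i ⊎ Fin j) λ p →
  (∀ u v (s : Fin i) → p u ≡ inj₁ s → p v ≡ inj₁ s → ¬ Edge G u v) ×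
  (∀ u v (t : Fin j) → p u ≡ inj₂ t → p v ≡ inj₂ t → u ≢ v → Edge G u v)

Attains : GraphClass → ℕ → Set₁
Attains X m = Σ ℕ λ i → i ≤ m × (E i (m ∸ i) ⊆G X)

IndexIs : GraphClass → ℕ → Set₁
IndexIs X m = Attains X m × (∀ m' → Attains X m' → m' ≤ m)

{-# OPTIONS --safe #-}
-- Edgeless graphs are represented by the word that lists every node as one block of k ≥ 2
-- copies; it is k-uniform and 1-local, so the index is at least 1.
--
-- Conversely, once i + j ≥ 2, E_{i,j} contains 2^{M²} distinct graphs on the same 2M + 2 nodes:
-- two sides, each a clique or an independent set, with arbitrary edges between them except that
-- node 0 of each side sees the whole other side. In a word representing a graph without isolated
-- nodes no letter occurs twice in a row, so when a letter gets marked each of its occurrences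
-- either starts a block or directly follows a block of the previous stage; hence a k-local word
-- uses each letter at most 2k times, and so does a (k + 1)-uniform one. Words of length at most
-- 2k(2M + 2) over 2M + 2 letters are too few to represent all 2^{M²} graphs.
module Submission where

open import Defs hiding (sym)
open import Data.Nat using (ℕ; zero; suc; _+_; _*_; _^_; _∸_; _≤_; _<_; z≤n; s≤s; NonZero)
open import Data.Nat.Properties
  using (≤-refl; ≤-trans; +-mono-≤; +-monoˡ-≤; +-identityʳ; +-suc; *-zeroʳ; *-identityʳ; *-distribˡ-+;
         *-mono-≤; *-monoˡ-≤; *-monoʳ-≤; *-monoˡ-<; m≤m+n; m≤n+m; <⇒≱; m^n>0; m^n≢0;
         ^-monoˡ-≤; ^-monoʳ-<; ^-distribˡ-+-*; ^-*-assoc; module ≤-Reasoning)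
open import Data.Nat.Solver using (module +-*-Solver)
open import Data.Bool using (Bool; true; false; not; if_then_else_)
open import Data.Fin using (Fin; zero; suc; _≟_; splitAt; join; _↑ˡ_; _↑ʳ_; combine; finToFun; funToFin)
open import Data.Fin.Patterns using (1F)
open import Data.Fin.Properties
  using (suc-injective; splitAt-↑ˡ; splitAt-↑ʳ; join-splitAt; combine-surjective;
         funToFin-finToFin; finToFun-funToFin; injective⇒≤)
open import Data.List using (List; []; _∷_; [_]; _++_; length; filter; replicate; concatMap; take; drop; allFin; head)
open import Data.List.Properties
  using (length-++; length-++-≤ˡ; length-++-sucʳ; filter-++; filter-accept; filter-reject; filter-none;
         concatMap-++; take++drop≡id)
open import Data.List.Membership.Propositional using (_∈_; _∉_)
open import Data.List.Membership.Propositional.Properties using (∈-++⁺ˡ; ∈-++⁺ʳ; ∈-++⁻; ∈-∃++; ∈-allFin)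
import Data.List.Membership.DecPropositional as DecMembership
open import Data.List.Relation.Unary.Any using (here; there)
open import Data.List.Relation.Unary.All as All using (All; []; _∷_)
open import Data.List.Relation.Unary.All.Properties using (concat⁺; map⁺; replicate⁺)
open import Data.List.Relation.Unary.AllPairs using (_∷_)
open import Data.List.Relation.Unary.Unique.Propositional using (Unique)
open import Data.List.Relation.Unary.Unique.Propositional.Properties using (allFin⁺)
open import Data.List.Relation.Binary.Disjoint.Propositional using (Disjoint)
open import Data.Maybe using (just)
open import Data.Product using (Σ-syntax; ∃-syntax; _×_; _,_; proj₁; proj₂)
open import Data.Sum using (_⊎_; inj₁; inj₂)
open import Data.Unit using (⊤; tt)
open import Data.Empty using (⊥; ⊥-elim)
open import Function using (_∘_)
open import Function.Bundles using (_⇔_; mk⇔; Equivalence)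
open import Function.Definitions using (Injective)
import Function.Properties.Equivalence as ⇔
open import Level using (0ℓ)
open import Relation.Nullary using (¬_; does; yes; no)
open import Relation.Nullary.Decidable using (dec-true; dec-false; does-⇔)
open import Relation.Unary using (Pred; Decidable)
open import Relation.Binary.PropositionalEquality
  using (_≡_; _≢_; _≗_; refl; sym; trans; cong; cong₂; subst; subst₂; ≢-sym; module ≡-Reasoning)

data Doubled {A : Set} (a : A) : List A → Set where
  here  : ∀ {xs} → Doubled a (a ∷ a ∷ xs)
  there : ∀ {x xs} → Doubled a xs → Doubled a (x ∷ xs)

Doubled⇒∈ : ∀ {A : Set} {a : A} {xs} → Doubled a xs → a ∈ xs
Doubled⇒∈ here      = here refl
Doubled⇒∈ (there d) = there (Doubled⇒∈ d)

Doubled-++⁺ʳ : ∀ {A : Set} {a : A} xs {ys} → Doubled a ys → Doubled a (xs ++ ys)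
Doubled-++⁺ʳ []       d = d
Doubled-++⁺ʳ (x ∷ xs) d = there (Doubled-++⁺ʳ xs d)

Doubled-filter⁺ : ∀ {A : Set} {P : Pred A 0ℓ} (P? : Decidable P) {a xs} → P a → Doubled a xs →
                  Doubled a (filter P? xs)
Doubled-filter⁺ P? {a} Pa (here {xs})
  rewrite filter-accept P? {xs = a ∷ xs} Pa | filter-accept P? {xs = xs} Pa = here
Doubled-filter⁺ P? Pa (there {x} d) with does (P? x)
... | true  = there (Doubled-filter⁺ P? Pa d)
... | false = Doubled-filter⁺ P? Pa d

¬Doubled-altFrom : ∀ {A : Set} {a x y : A} l → x ≢ y → ¬ Doubled a (altFrom x y l)
¬Doubled-altFrom (suc (suc l)) x≢y here      = x≢y refl
¬Doubled-altFrom (suc l)       x≢y (there d) = ¬Doubled-altFrom l (≢-sym x≢y) d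

Doubled⇒¬Alternate : ∀ {n} {w : List (Fin n)} {a b} → Doubled a w → ¬ Alternate w a b
Doubled⇒¬Alternate {w = w} {a} {b} d (a≢b , l , _ , alt) = ¬alternating alt
  where
  restricted : Doubled a (restrict w a b)
  restricted = Doubled-filter⁺ _ (inj₁ refl) d
  ¬alternating : ¬ (restrict w a b ≡ altFrom a b l ⊎ restrict w a b ≡ altFrom b a l)
  ¬alternating (inj₁ ab) = ¬Doubled-altFrom l a≢b (subst (Doubled a) ab restricted)
  ¬alternating (inj₂ ba) = ¬Doubled-altFrom l (≢-sym a≢b) (subst (Doubled a) ba restricted)

adjacent⇒¬Doubled : ∀ G {w a b} → Represents G w → Edge G a b → ¬ Doubled a w
adjacent⇒¬Doubled G {a = a} {b} (_ , rep) e d = Doubled⇒¬Alternate d (Equivalence.to (rep a b a≢b) e)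
  where
  a≢b : a ≢ b
  a≢b refl = irrefl G e

occ-++ : ∀ {n} (v : Fin n) xs ys → occ v (xs ++ ys) ≡ occ v xs + occ v ys
occ-++ v xs ys = trans (cong length (filter-++ (_≟ v) xs ys)) (length-++ (filter (_≟ v) xs))

occ-replicate : ∀ {n} (v x : Fin n) k → occ v (replicate k x) ≡ k * occ v [ x ]
occ-replicate v x zero    = refl
occ-replicate v x (suc k) = trans (occ-++ v [ x ] (replicate k x)) (cong (occ v [ x ] +_) (occ-replicate v x k))

occ-unique : ∀ {n} {v : Fin n} {xs} → Unique xs → v ∈ xs → occ v xs ≡ 1
occ-unique {v = v} {_ ∷ xs} (v∉xs ∷ _) (here refl) = begin
  occ v (v ∷ xs)  ≡⟨ cong length (filter-accept (_≟ v) refl) ⟩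
  suc (occ v xs)  ≡⟨ cong (suc ∘ length) (filter-none (_≟ v) (All.map ≢-sym v∉xs)) ⟩
  1               ∎
  where open ≡-Reasoning
occ-unique {v = v} (x∉xs ∷ xs!) (there v∈xs) =
  trans (cong length (filter-reject (_≟ v) (All.lookup x∉xs v∈xs))) (occ-unique xs! v∈xs)

dropZeros : ∀ {n} → List (Fin (suc n)) → List (Fin n)
dropZeros []          = []
dropZeros (zero ∷ w)  = dropZeros w
dropZeros (suc x ∷ w) = x ∷ dropZeros w

length-dropZeros : ∀ {n} (w : List (Fin (suc n))) → length w ≡ occ zero w + length (dropZeros w)
length-dropZeros []          = refl
length-dropZeros (zero ∷ w)  = cong suc (length-dropZeros w)
length-dropZeros (suc x ∷ w) = trans (cong suc (length-dropZeros w)) (sym (+-suc (occ zero w) _))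

occ-dropZeros : ∀ {n} (v : Fin n) w → occ v (dropZeros w) ≡ occ (suc v) w
occ-dropZeros v []          = refl
occ-dropZeros v (zero ∷ w)  = occ-dropZeros v w
occ-dropZeros v (suc x ∷ w) with does (x ≟ v)
... | true  = cong suc (occ-dropZeros v w)
... | false = occ-dropZeros v w

length≤n*c : ∀ {n c} (w : List (Fin n)) → (∀ v → occ v w ≤ c) → length w ≤ n * c
length≤n*c {zero}  []       _     = z≤n
length≤n*c {zero}  (() ∷ _) _
length≤n*c {suc n} {c} w occ≤c = begin
  length w                          ≡⟨ length-dropZeros w ⟩
  occ zero w + length (dropZeros w) ≤⟨ +-mono-≤ (occ≤c zero) (length≤n*c (dropZeros w) dropZeros-occ≤c) ⟩
  c + n * c                         ∎
  where
  open ≤-Reasoning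
  dropZeros-occ≤c : ∀ v → occ v (dropZeros w) ≤ c
  dropZeros-occ≤c v = subst (_≤ c) (sym (occ-dropZeros v w)) (occ≤c (suc v))

module _ {A : Set} (m : A → Bool) where

  blocksFrom-unmarked : ∀ {p xs} → All (λ x → m x ≡ false) xs → blocksFrom m p xs ≡ 0
  blocksFrom-unmarked []                      = refl
  blocksFrom-unmarked {xs = x ∷ _} (mx ∷ mxs) rewrite mx = blocksFrom-unmarked mxs

  blocksFrom-marked-++ : ∀ {xs ys} → All (λ x → m x ≡ true) xs →
                         blocksFrom m true (xs ++ ys) ≡ blocksFrom m true ys
  blocksFrom-marked-++ []                 = refl
  blocksFrom-marked-++ {x ∷ _} (mx ∷ mxs) rewrite mx = blocksFrom-marked-++ mxs

  marked-prefix⇒blocks≤1 : ∀ {xs ys} → All (λ x → m x ≡ true) xs → All (λ x → m x ≡ false) ys →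
                            blocksFrom m false (xs ++ ys) ≤ 1
  marked-prefix⇒blocks≤1 [] mys rewrite blocksFrom-unmarked {false} mys = z≤n
  marked-prefix⇒blocks≤1 {x ∷ _} {ys} (mx ∷ mxs) mys
    rewrite mx | blocksFrom-marked-++ {ys = ys} mxs | blocksFrom-unmarked {true} mys = ≤-refl

-- Since a never occurs twice in a row, each occurrence of a either starts a block of m′ or
-- directly follows a block of m. In the invariant, p and p′ record whether the previous letter is
-- marked by m and by m′, and ⟦ p ⟧ is the block of m that the next a may still be charged to.
module _ {n} {m m′ : Fin n → Bool} {a : Fin n}
         (m-a : m a ≡ false) (m′-a : m′ a ≡ true) (m′≡m : ∀ x → x ≢ a → m′ x ≡ m x) where

  private
    ⟦_⟧ : Bool → ℕ
    ⟦ p ⟧ = if p then 1 else 0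

    slack : ∀ {o c} B B′ c₁ c₂ c₃ → o ≤ c + (B + B′) → c ≤ c₁ + c₂ + c₃ →
            o ≤ c₃ + ((c₁ + B) + (c₂ + B′))
    slack {o} {c} B B′ c₁ c₂ c₃ o≤ c≤ = begin
      o                            ≤⟨ o≤ ⟩
      c + (B + B′)                 ≤⟨ +-mono-≤ c≤ (≤-refl {B + B′}) ⟩
      c₁ + c₂ + c₃ + (B + B′)      ≡⟨ solve 5 (λ B B′ c₁ c₂ c₃ → c₁ :+ c₂ :+ c₃ :+ (B :+ B′)
                                                                := c₃ :+ ((c₁ :+ B) :+ (c₂ :+ B′))) refl B B′ c₁ c₂ c₃ ⟩
      c₃ + ((c₁ + B) + (c₂ + B′))  ∎
      where open ≤-Reasoning
            open +-*-Solver

    Doubled-head : ∀ {xs} → head xs ≡ just a → Doubled a (a ∷ xs)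
    Doubled-head {_ ∷ _} refl = here

  occ≤blocksFrom : ∀ p p′ xs → ¬ Doubled a xs → (head xs ≡ just a → p ≡ p′) →
                   occ a xs ≤ ⟦ p ⟧ + (blocksFrom m p xs + blocksFrom m′ p′ xs)
  occ≤blocksFrom p p′ []       _  _     = z≤n
  occ≤blocksFrom p p′ (x ∷ xs) ¬d p≡p′ with x ≟ a
  ... | yes refl with refl ← p≡p′ refl rewrite m-a | m′-a = after-a p
    where
    B  = blocksFrom m false xs
    B′ = blocksFrom m′ true xs
    ih = occ≤blocksFrom false true xs (¬d ∘ there) (⊥-elim ∘ ¬d ∘ Doubled-head)
    after-a : ∀ p → suc (occ a xs) ≤ ⟦ p ⟧ + ((0 + B) + (⟦ not p ⟧ + B′))
    after-a true  = slack B B′ 0 0 1 (s≤s ih) ≤-refl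
    after-a false = slack B B′ 0 1 0 (s≤s ih) ≤-refl
  ... | no x≢a rewrite m′≡m x x≢a with m x
  ...   | true  = slack B B′ ⟦ not p ⟧ ⟦ not p′ ⟧ ⟦ p ⟧ ih (1≤ p)
    where
    B  = blocksFrom m true xs
    B′ = blocksFrom m′ true xs
    ih = occ≤blocksFrom true true xs (¬d ∘ there) (λ _ → refl)
    1≤ : ∀ p → 1 ≤ ⟦ not p ⟧ + ⟦ not p′ ⟧ + ⟦ p ⟧
    1≤ true  = m≤n+m 1 _
    1≤ false = s≤s z≤n
  ...   | false = slack (blocksFrom m false xs) (blocksFrom m′ false xs) 0 0 ⟦ p ⟧ ih z≤n
    where
    ih = occ≤blocksFrom false false xs (¬d ∘ there) (λ _ → refl)

  occ≤blocks+blocks : ∀ {w} → ¬ Doubled a w → occ a w ≤ blocksFrom m false w + blocksFrom m′ false w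
  occ≤blocks+blocks {w} ¬d = occ≤blocksFrom false false w ¬d (λ _ → refl)

Unique-++⇒Disjoint : ∀ {A : Set} (xs : List A) {ys} → Unique (xs ++ ys) → Disjoint xs ys
Unique-++⇒Disjoint (x ∷ xs) (x∉ ∷ _)   (here refl , x∈ys)  = All.lookup x∉ (∈-++⁺ʳ xs x∈ys) refl
Unique-++⇒Disjoint (x ∷ xs) (_ ∷ xs!) (there v∈xs , v∈ys) = Unique-++⇒Disjoint xs xs! (v∈xs , v∈ys)

take-length-++ : ∀ {A : Set} (xs : List A) {ys} → take (length xs) (xs ++ ys) ≡ xs
take-length-++ []       = refl
take-length-++ (x ∷ xs) = cong (x ∷_) (take-length-++ xs)

take-suc-length-++ : ∀ {A : Set} (xs : List A) {y ys} → take (suc (length xs)) (xs ++ y ∷ ys) ≡ xs ++ [ y ]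
take-suc-length-++ []       = refl
take-suc-length-++ (x ∷ xs) = cong (x ∷_) (take-suc-length-++ xs)

occ≤markedBlocks-∷ʳ : ∀ {n} {ys : List (Fin n)} {v w} → v ∉ ys → ¬ Doubled v w →
                      occ v w ≤ markedBlocks ys w + markedBlocks (ys ++ [ v ]) w
occ≤markedBlocks-∷ʳ {n} {ys} {v} v∉ys = occ≤blocks+blocks m-v m′-v m′≡m
  where
  open DecMembership (_≟_ {n}) using (_∈?_)
  m-v : does (v ∈? ys) ≡ false
  m-v = dec-false (v ∈? ys) v∉ys
  m′-v : does (v ∈? ys ++ [ v ]) ≡ true
  m′-v = dec-true (v ∈? ys ++ [ v ]) (∈-++⁺ʳ ys (here refl))
  m′≡m : ∀ x → x ≢ v → does (x ∈? ys ++ [ v ]) ≡ does (x ∈? ys)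
  m′≡m x x≢v = does-⇔ (mk⇔ ∈ys ∈-++⁺ˡ) (x ∈? ys ++ [ v ]) (x ∈? ys)
    where
    ∈ys : x ∈ ys ++ [ v ] → x ∈ ys
    ∈ys x∈ with ∈-++⁻ ys x∈
    ... | inj₁ x∈ys       = x∈ys
    ... | inj₂ (here x≡v) = ⊥-elim (x≢v x≡v)

local⇒occ≤ : ∀ {n k} {w : List (Fin n)} → Local k w → (∀ v → v ∈ w) → (∀ v → ¬ Doubled v w) →
             ∀ v → occ v w ≤ k + k
local⇒occ≤ {k = k} {w} (σ , (σ! , σ≈w) , bounded) ∈w ¬d v
  with ys , zs , refl ← ∈-∃++ (Equivalence.from (σ≈w v) (∈w v)) =
  ≤-trans (occ≤markedBlocks-∷ʳ v∉ys (¬d v)) (+-mono-≤ before after)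
  where
  v∉ys : v ∉ ys
  v∉ys v∈ys = Unique-++⇒Disjoint ys σ! (v∈ys , here refl)
  before : markedBlocks ys w ≤ k
  before = subst (λ σ′ → markedBlocks σ′ w ≤ k) (take-length-++ ys) (bounded (length ys) (length-++-≤ˡ ys))
  after : markedBlocks (ys ++ [ v ]) w ≤ k
  after = subst (λ σ′ → markedBlocks σ′ w ≤ k) (take-suc-length-++ ys) (bounded (suc (length ys)) v-marked)
    where
    v-marked : suc (length ys) ≤ length (ys ++ v ∷ zs)
    v-marked = subst (suc (length ys) ≤_) (sym (length-++-sucʳ ys v zs)) (s≤s (length-++-≤ˡ ys))

NoIsolatedNodes : Graph → Set
NoIsolatedNodes G = ∀ u → ∃[ v ] Edge G u v

R≤ : ℕ → GraphClass
R≤ c G = Σ[ w ∈ List (Fin (n G)) ] Represents G w × (∀ v → occ v w ≤ c)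

R⊆R≤ : ∀ {k} → 1 ≤ k → R (suc k) ⊆G R≤ (k + k)
R⊆R≤ {suc k} _ G (w , rep , uniform) =
  w , rep , λ v → subst (_≤ suc k + suc k) (sym (uniform v)) (s≤s (m≤n+m (suc k) k))

L⊆R≤ : ∀ {k} G → NoIsolatedNodes G → L k G → R≤ (k + k) G
L⊆R≤ G noIsolated (w , rep , local) =
  w , rep , local⇒occ≤ local (proj₁ rep) (λ v → adjacent⇒¬Doubled G rep (proj₂ (noIsolated v)))

Edgeless : Graph → Set
Edgeless G = ∀ u v → ¬ Edge G u v

E₁₀⇒Edgeless : ∀ G → E 1 0 G → Edgeless G
E₁₀⇒Edgeless G (p , independent , _) u v with p u in pu | p v in pv
... | inj₁ zero | inj₁ zero = independent u v zero pu pv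

repeatEach : ∀ {A : Set} → ℕ → List A → List A
repeatEach k = concatMap (replicate k)

All-repeatEach⁺ : ∀ {A : Set} {P : A → Set} k {xs} → All P xs → All P (repeatEach k xs)
All-repeatEach⁺ k = concat⁺ ∘ map⁺ ∘ All.map (replicate⁺ k)

Doubled-repeatEach : ∀ {A : Set} {a : A} r {xs} → a ∈ xs → Doubled a (repeatEach (2 + r) xs)
Doubled-repeatEach r         (here refl)  = here
Doubled-repeatEach r {x ∷ _} (there a∈xs) = Doubled-++⁺ʳ (replicate (2 + r) x) (Doubled-repeatEach r a∈xs)

occ-repeatEach : ∀ {n} (v : Fin n) k xs → occ v (repeatEach k xs) ≡ k * occ v xs
occ-repeatEach v k []       = sym (*-zeroʳ k)
occ-repeatEach v k (x ∷ xs) = begin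
  occ v (replicate k x ++ repeatEach k xs)         ≡⟨ occ-++ v (replicate k x) (repeatEach k xs) ⟩
  occ v (replicate k x) + occ v (repeatEach k xs)  ≡⟨ cong₂ _+_ (occ-replicate v x k) (occ-repeatEach v k xs) ⟩
  k * occ v [ x ] + k * occ v xs                   ≡⟨ *-distribˡ-+ k (occ v [ x ]) (occ v xs) ⟨
  k * (occ v [ x ] + occ v xs)                     ≡⟨ cong (k *_) (occ-++ v [ x ] xs) ⟨
  k * occ v (x ∷ xs)                               ∎
  where open ≡-Reasoning

repeatEach-represents : ∀ G r → Edgeless G → Represents G (repeatEach (2 + r) (allFin (n G)))
repeatEach-represents G r edgeless =
  (λ v → Doubled⇒∈ (doubled v)) ,
  (λ a b _ → mk⇔ (⊥-elim ∘ edgeless a b) (⊥-elim ∘ Doubled⇒¬Alternate (doubled a)))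
  where
  doubled : ∀ v → Doubled v (repeatEach (2 + r) (allFin (n G)))
  doubled v = Doubled-repeatEach r (∈-allFin v)

-- Marking the letters in the order of their blocks keeps the marked positions a prefix.
markedBlocks-repeatEach : ∀ {n} k i {xs : List (Fin n)} → Unique xs →
                          markedBlocks (take i xs) (repeatEach k xs) ≤ 1
markedBlocks-repeatEach {n} k i {xs} xs! =
  subst (λ w → markedBlocks (take i xs) w ≤ 1) split
        (marked-prefix⇒blocks≤1 (λ x → does (x ∈? take i xs)) marked unmarked)
  where
  open DecMembership (_≟_ {n}) using (_∈?_)
  split : repeatEach k (take i xs) ++ repeatEach k (drop i xs) ≡ repeatEach k xs
  split = trans (sym (concatMap-++ (replicate k) (take i xs) (drop i xs))) (cong (repeatEach k) (take++drop≡id i xs))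
  disjoint : Disjoint (take i xs) (drop i xs)
  disjoint = Unique-++⇒Disjoint (take i xs) (subst Unique (sym (take++drop≡id i xs)) xs!)
  marked : All (λ x → does (x ∈? take i xs) ≡ true) (repeatEach k (take i xs))
  marked = All-repeatEach⁺ k (All.tabulate (λ {x} → dec-true (x ∈? take i xs)))
  unmarked : All (λ x → does (x ∈? take i xs) ≡ false) (repeatEach k (drop i xs))
  unmarked = All-repeatEach⁺ k (All.tabulate λ {x} x∈drop →
    dec-false (x ∈? take i xs) (λ x∈take → disjoint (x∈take , x∈drop)))

E₁₀⊆R : ∀ {k} → 2 ≤ k → E 1 0 ⊆G R k
E₁₀⊆R {suc (suc r)} (s≤s (s≤s z≤n)) G G∈E =
  word , repeatEach-represents G r (E₁₀⇒Edgeless G G∈E) , uniform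
  where
  word = repeatEach (2 + r) (allFin (n G))
  uniform : ∀ v → occ v word ≡ 2 + r
  uniform v = begin
    occ v word                      ≡⟨ occ-repeatEach v (2 + r) (allFin (n G)) ⟩
    (2 + r) * occ v (allFin (n G))  ≡⟨ cong ((2 + r) *_) (occ-unique (allFin⁺ (n G)) (∈-allFin v)) ⟩
    (2 + r) * 1                     ≡⟨ *-identityʳ (2 + r) ⟩
    2 + r                           ∎
    where open ≡-Reasoning

E₁₀⊆L : ∀ {k} → 1 ≤ k → E 1 0 ⊆G L k
E₁₀⊆L 1≤k G G∈E =
  repeatEach 2 (allFin (n G)) , represents ,
  allFin (n G) , (allFin⁺ (n G) , λ v → mk⇔ (λ _ → proj₁ represents v) (λ _ → ∈-allFin v)) ,
  λ i _ → ≤-trans (markedBlocks-repeatEach 2 i (allFin⁺ (n G))) 1≤k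
  where
  represents = repeatEach-represents G 0 (E₁₀⇒Edgeless G G∈E)

pad : ∀ {n} → List (Fin n) → (L : ℕ) → Fin L → Fin (suc n)
pad []      _       _       = zero
pad (_ ∷ _) zero    ()
pad (x ∷ _) (suc _) zero    = suc x
pad (_ ∷ w) (suc L) (suc i) = pad w L i

pad-injective : ∀ {n L} {w w′ : List (Fin n)} → length w ≤ L → length w′ ≤ L →
                pad w L ≗ pad w′ L → w ≡ w′
pad-injective {w = []}    {[]}    _         _          _  = refl
pad-injective {w = []}    {_ ∷ _} _         (s≤s _)    eq with () ← eq zero
pad-injective {w = _ ∷ _} {[]}    (s≤s _)   _          eq with () ← eq zero
pad-injective {w = _ ∷ _} {_ ∷ _} (s≤s w≤L) (s≤s w′≤L) eq =
  cong₂ _∷_ (suc-injective (eq zero)) (pad-injective w≤L w′≤L (eq ∘ suc))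

injection-into-short-words⇒≤ : ∀ {N n L} (f : Fin N → List (Fin n)) → Injective _≡_ _≡_ f →
                               (∀ t → length (f t) ≤ L) → N ≤ suc n ^ L
injection-into-short-words⇒≤ {N} {n} {L} f f-injective short = injective⇒≤ encode-injective
  where
  encode : Fin N → Fin (suc n ^ L)
  encode t = funToFin (pad (f t) L)
  encode-injective : Injective _≡_ _≡_ encode
  encode-injective {s} {t} eq = f-injective (pad-injective (short s) (short t) same-pad)
    where
    same-pad : pad (f s) L ≗ pad (f t) L
    same-pad i = begin
      pad (f s) L i          ≡⟨ finToFun-funToFin (pad (f s) L) i ⟨
      finToFun (encode s) i  ≡⟨ cong (λ e → finToFun e i) eq ⟩
      finToFun (encode t) i  ≡⟨ finToFun-funToFin (pad (f t) L) i ⟩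
      pad (f t) L i          ∎
      where open ≡-Reasoning

funToFin-cong : ∀ {m n} {f g : Fin m → Fin n} → f ≗ g → funToFin f ≡ funToFin g
funToFin-cong {zero}  _   = refl
funToFin-cong {suc m} f≗g = cong₂ combine (f≗g zero) (funToFin-cong (f≗g ∘ suc))

finToFun-combine-injective : ∀ {k m n} {s t : Fin (k ^ (m * n))} →
                             (∀ u v → finToFun s (combine u v) ≡ finToFun t (combine u v)) → s ≡ t
finToFun-combine-injective {k} {m} {n} {s} {t} agree = begin
  s                                  ≡⟨ funToFin-finToFin {m * n} {k} s ⟨
  funToFin (finToFun {k} {m * n} s)  ≡⟨ funToFin-cong {m * n} {k} same ⟩
  funToFin (finToFun {k} {m * n} t)  ≡⟨ funToFin-finToFin {m * n} {k} t ⟩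
  t                                  ∎
  where
  open ≡-Reasoning
  same : finToFun {k} {m * n} s ≗ finToFun t
  same i with u , v , refl ← combine-surjective {m} {n} i = agree u v

≡1F⇔⇒≡ : ∀ {b c : Fin 2} → (b ≡ 1F ⇔ c ≡ 1F) → b ≡ c
≡1F⇔⇒≡ {zero}     {zero}     _   = refl
≡1F⇔⇒≡ {suc zero} {suc zero} _   = refl
≡1F⇔⇒≡ {zero}     {suc zero} b⇔c with () ← Equivalence.from b⇔c refl
≡1F⇔⇒≡ {suc zero} {zero}     b⇔c with () ← Equivalence.to b⇔c refl

splitAt-injective : ∀ m {n} {a b : Fin (m + n)} → splitAt m a ≡ splitAt m b → a ≡ b
splitAt-injective m {n} {a} {b} eq = trans (sym (join-splitAt m n a)) (trans (cong (join m n) eq) (join-splitAt m n b))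

-- The edges inside a side put into part P: none if P is one of the independent sets (inj₁),
-- all if it is one of the cliques (inj₂).
Inside : ∀ {i j m} → Fin i ⊎ Fin j → Fin m → Fin m → Set
Inside (inj₁ _) _ _  = ⊥
Inside (inj₂ _) u u′ = u ≢ u′

Inside-sym : ∀ {i j m} (P : Fin i ⊎ Fin j) {u u′ : Fin m} → Inside P u u′ → Inside P u′ u
Inside-sym (inj₂ _) = ≢-sym

Inside-irrefl : ∀ {i j m} (P : Fin i ⊎ Fin j) {u : Fin m} → ¬ Inside P u u
Inside-irrefl (inj₂ _) u≢u = u≢u refl

-- Node 0 of each side is adjacent to all of the other side, which rules out isolated nodes;
-- the remaining M × M cross edges are the bits of t.
Cross : ∀ M → Fin (2 ^ (M * M)) → Fin (suc M) → Fin (suc M) → Set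
Cross M t zero    _       = ⊤
Cross M t (suc u) zero    = ⊤
Cross M t (suc u) (suc v) = finToFun t (combine u v) ≡ 1F

Cross-zeroʳ : ∀ M (t : Fin (2 ^ (M * M))) u → Cross M t u zero
Cross-zeroʳ M t zero    = tt
Cross-zeroʳ M t (suc u) = tt

module TwoPart (M : ℕ) {i j} (PL PR : Fin i ⊎ Fin j) where

  Node : Set
  Node = Fin (suc M) ⊎ Fin (suc M)

  Adjacent : Fin (2 ^ (M * M)) → Node → Node → Set
  Adjacent t (inj₁ u) (inj₁ u′) = Inside PL u u′
  Adjacent t (inj₂ v) (inj₂ v′) = Inside PR v v′
  Adjacent t (inj₁ u) (inj₂ v)  = Cross M t u v
  Adjacent t (inj₂ v) (inj₁ u)  = Cross M t u v

  Adjacent-sym : ∀ t x y → Adjacent t x y → Adjacent t y x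
  Adjacent-sym t (inj₁ _) (inj₁ _) = Inside-sym PL
  Adjacent-sym t (inj₂ _) (inj₂ _) = Inside-sym PR
  Adjacent-sym t (inj₁ _) (inj₂ _) = λ e → e
  Adjacent-sym t (inj₂ _) (inj₁ _) = λ e → e

  Adjacent-irrefl : ∀ t x → ¬ Adjacent t x x
  Adjacent-irrefl t (inj₁ _) = Inside-irrefl PL
  Adjacent-irrefl t (inj₂ _) = Inside-irrefl PR

  graph : Fin (2 ^ (M * M)) → Graph
  graph t = record
    { n      = suc M + suc M
    ; Edge   = λ a b → Adjacent t (splitAt (suc M) a) (splitAt (suc M) b)
    ; sym    = λ {a} {b} → Adjacent-sym t (splitAt (suc M) a) (splitAt (suc M) b)
    ; irrefl = λ {a} → Adjacent-irrefl t (splitAt (suc M) a)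
    }

  graph-∈E : PL ≢ PR → ∀ t → E i j (graph t)
  graph-∈E PL≢PR t = part ∘ splitAt (suc M) , independent , clique
    where
    part : Node → Fin i ⊎ Fin j
    part (inj₁ _) = PL
    part (inj₂ _) = PR
    Inside-independent : ∀ {P : Fin i ⊎ Fin j} {s} {u u′ : Fin (suc M)} → P ≡ inj₁ s → ¬ Inside P u u′
    Inside-independent refl ()
    Inside-clique : ∀ {P : Fin i ⊎ Fin j} {s} {u u′ : Fin (suc M)} → P ≡ inj₂ s → u ≢ u′ → Inside P u u′
    Inside-clique refl u≢u′ = u≢u′
    independent : ∀ a b s → part (splitAt (suc M) a) ≡ inj₁ s → part (splitAt (suc M) b) ≡ inj₁ s →
                  ¬ Edge (graph t) a b
    independent a b s pa pb with splitAt (suc M) a | splitAt (suc M) b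
    ... | inj₁ _ | inj₁ _ = Inside-independent pa
    ... | inj₂ _ | inj₂ _ = Inside-independent pa
    ... | inj₁ _ | inj₂ _ = ⊥-elim (PL≢PR (trans pa (sym pb)))
    ... | inj₂ _ | inj₁ _ = ⊥-elim (PL≢PR (trans pb (sym pa)))
    clique : ∀ a b s → part (splitAt (suc M) a) ≡ inj₂ s → part (splitAt (suc M) b) ≡ inj₂ s →
             a ≢ b → Edge (graph t) a b
    clique a b s pa pb a≢b with splitAt (suc M) a in ea | splitAt (suc M) b in eb
    ... | inj₁ _ | inj₁ _ = Inside-clique pa λ { refl → a≢b (splitAt-injective (suc M) (trans ea (sym eb))) }
    ... | inj₂ _ | inj₂ _ = Inside-clique pa λ { refl → a≢b (splitAt-injective (suc M) (trans ea (sym eb))) }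
    ... | inj₁ _ | inj₂ _ = ⊥-elim (PL≢PR (trans pa (sym pb)))
    ... | inj₂ _ | inj₁ _ = ⊥-elim (PL≢PR (trans pb (sym pa)))

  graph-noIsolatedNodes : ∀ t → NoIsolatedNodes (graph t)
  graph-noIsolatedNodes t a with splitAt (suc M) a
  ... | inj₁ u = suc M ↑ʳ zero ,
                 subst (Adjacent t (inj₁ u)) (sym (splitAt-↑ʳ (suc M) (suc M) zero)) (Cross-zeroʳ M t u)
  ... | inj₂ v = zero ↑ˡ suc M ,
                 subst (λ x → Adjacent t x (inj₂ v)) (sym (splitAt-↑ˡ (suc M) zero (suc M))) tt

  graph-injective : ∀ {s t w} → Represents (graph s) w → Represents (graph t) w → s ≡ t
  graph-injective {s} {t} (_ , rep-s) (_ , rep-t) = finToFun-combine-injective same-bit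
    where
    same-bit : ∀ u v → finToFun s (combine u v) ≡ finToFun t (combine u v)
    same-bit u v =
      ≡1F⇔⇒≡ (subst₂ _⇔_ (cross-edge s) (cross-edge t) (⇔.trans (rep-s a b a≢b) (⇔.sym (rep-t a b a≢b))))
      where
      a = suc u ↑ˡ suc M
      b = suc M ↑ʳ suc v
      cross-edge : ∀ t → Edge (graph t) a b ≡ (finToFun t (combine u v) ≡ 1F)
      cross-edge t =
        cong₂ (Adjacent t) (splitAt-↑ˡ (suc M) (suc u) (suc M)) (splitAt-↑ʳ (suc M) (suc M) (suc v))
      a≢b : a ≢ b
      a≢b a≡b with () ← trans (sym (splitAt-↑ˡ (suc M) (suc u) (suc M)))
                              (trans (cong (splitAt (suc M)) a≡b) (splitAt-↑ʳ (suc M) (suc M) (suc v)))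

  R≤-count : ∀ c → (∀ t → R≤ c (graph t)) → 2 ^ (M * M) ≤ suc (suc M + suc M) ^ ((suc M + suc M) * c)
  R≤-count c represented = injection-into-short-words⇒≤ word word-injective short
    where
    word : Fin (2 ^ (M * M)) → List (Fin (suc M + suc M))
    word t = proj₁ (represented t)
    word-injective : Injective _≡_ _≡_ word
    word-injective {s} {t} eq =
      graph-injective (subst (Represents (graph s)) eq (proj₁ (proj₂ (represented s)))) (proj₁ (proj₂ (represented t)))
    short : ∀ t → length (word t) ≤ (suc M + suc M) * c
    short t = length≤n*c (word t) (proj₂ (proj₂ (represented t)))

n<2^n : ∀ n → n < 2 ^ n
n<2^n zero    = s≤s z≤n
n<2^n (suc n) = subst (2 + n ≤_) (cong (2 ^ n +_) (sym (+-identityʳ (2 ^ n)))) (+-mono-≤ (m^n>0 2 n) (n<2^n n))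

-- Take a = 4c, b = 2a, M = 2^(2b) and N = 2M + 2 ≤ 4M. Then N + 1 ≤ 2^(2b + 3) and
-- (2b + 3)a < (b + 1)² ≤ M, so (N + 1)^(Nc) ≤ 2^((2b + 3)aM) < 2^(M²).
graphs-outnumber-words : ∀ c → ∃[ M ] suc (suc M + suc M) ^ ((suc M + suc M) * c) < 2 ^ (M * M)
graphs-outnumber-words c = M , (begin-strict
    suc N ^ (N * c)           ≤⟨ ^-monoˡ-≤ (N * c) suc-N≤ ⟩
    (2 ^ (3 + s)) ^ (N * c)   ≡⟨ ^-*-assoc 2 (3 + s) (N * c) ⟩
    2 ^ ((3 + s) * (N * c))   <⟨ ^-monoʳ-< 2 (s≤s (s≤s z≤n)) exponent< ⟩
    2 ^ (M * M)               ∎)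
  where
  open ≤-Reasoning
  open +-*-Solver
  a = 4 * c
  b = 2 * a
  s = b + b
  M = 2 ^ s
  N = suc M + suc M
  instance
    M≢0 : NonZero M
    M≢0 = m^n≢0 2 s
  N≤4M : N ≤ 4 * M
  N≤4M = begin
    suc M + suc M  ≡⟨ solve 1 (λ M → (con 1 :+ M) :+ (con 1 :+ M) := con 2 :+ con 2 :* M) refl M ⟩
    2 + 2 * M      ≤⟨ +-monoˡ-≤ (2 * M) (*-monoʳ-≤ 2 (m^n>0 2 s)) ⟩
    2 * M + 2 * M  ≡⟨ solve 1 (λ M → con 2 :* M :+ con 2 :* M := con 4 :* M) refl M ⟩
    4 * M          ∎
  suc-N≤ : suc N ≤ 2 ^ (3 + s)
  suc-N≤ = begin
    suc N          ≤⟨ +-monoˡ-≤ N (s≤s z≤n) ⟩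
    N + N          ≤⟨ +-mono-≤ N≤4M N≤4M ⟩
    4 * M + 4 * M  ≡⟨ solve 1 (λ M → con 4 :* M :+ con 4 :* M := con 2 :* (con 2 :* (con 2 :* M))) refl M ⟩
    2 ^ (3 + s)    ∎
  linear< : (3 + s) * a < M
  linear< = begin-strict
    (3 + s) * a            <⟨ s≤s (m≤m+n _ a) ⟩
    suc ((3 + s) * a + a)  ≡⟨ solve 1 (λ a → con 1 :+ ((con 3 :+ (con 2 :* a :+ con 2 :* a)) :* a :+ a)
                                              := (con 1 :+ con 2 :* a) :* (con 1 :+ con 2 :* a)) refl a ⟩
    suc b * suc b          ≤⟨ *-mono-≤ (n<2^n b) (n<2^n b) ⟩
    2 ^ b * 2 ^ b          ≡⟨ ^-distribˡ-+-* 2 b b ⟨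
    M                      ∎
  exponent< : (3 + s) * (N * c) < M * M
  exponent< = begin-strict
    (3 + s) * (N * c)      ≤⟨ *-monoʳ-≤ (3 + s) (*-monoˡ-≤ c N≤4M) ⟩
    (3 + s) * (4 * M * c)  ≡⟨ solve 3 (λ s M c → (con 3 :+ s) :* (con 4 :* M :* c)
                                              := (con 3 :+ s) :* (con 4 :* c) :* M) refl s M c ⟩
    (3 + s) * a * M        <⟨ *-monoˡ-< M linear< ⟩
    M * M                  ∎

distinctParts : ∀ i m → Σ[ P ∈ Fin i ⊎ Fin (2 + m ∸ i) ] Σ[ Q ∈ Fin i ⊎ Fin (2 + m ∸ i) ] P ≢ Q
distinctParts zero          m = inj₂ zero , inj₂ 1F , λ ()
distinctParts (suc zero)    m = inj₁ zero , inj₂ zero , λ ()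
distinctParts (suc (suc i)) m = inj₁ zero , inj₁ 1F , λ ()

index≤1 : ∀ X c → (∀ G → NoIsolatedNodes G → X G → R≤ c G) → ∀ m → Attains X m → m ≤ 1
index≤1 X c X⊆R≤ zero          _             = z≤n
index≤1 X c X⊆R≤ (suc zero)    _             = ≤-refl
index≤1 X c X⊆R≤ (suc (suc m)) (i , _ , E⊆X) = ⊥-elim (<⇒≱ outnumber (R≤-count c all-R≤))
  where
  M         = proj₁ (graphs-outnumber-words c)
  outnumber = proj₂ (graphs-outnumber-words c)
  P         = proj₁ (distinctParts i m)
  Q         = proj₁ (proj₂ (distinctParts i m))
  P≢Q       = proj₂ (proj₂ (distinctParts i m))
  open TwoPart M P Q
  all-R≤ : ∀ t → R≤ c (graph t)
  all-R≤ t = X⊆R≤ (graph t) (graph-noIsolatedNodes t) (E⊆X (graph t) (graph-∈E P≢Q t))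

mainTheorem3 : ∀ (k : ℕ) → 1 ≤ k → IndexIs (R (suc k)) 1 × IndexIs (L k) 1
mainTheorem3 k 1≤k =
  ((1 , ≤-refl , E₁₀⊆R (s≤s 1≤k)) , index≤1 (R (suc k)) (k + k) (λ G _ → R⊆R≤ 1≤k G)) ,
  ((1 , ≤-refl , E₁₀⊆L 1≤k)       , index≤1 (L k) (k + k) L⊆R≤)
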